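{- Let $\mathcal{T}$ be a non-empty finite set of mutually concordant nice triples, and define $\mathcal{T}_0=\mathcal{T}$, $\mathcal{T}_{k+1}=\{S\otimes T: S,T\in\mathcal{T}_k\}$ for $k\geqslant 0$. Let $\mu_k=\mu(\mathcal{T}_k)$, $M_k=M(\mathcal{T}_k)$, $\kappa_0=\kappa(\mathcal{T})$ and $K_0=K(\mathcal{T})$. Then for every $k\geqslant0$, $$\min\{2\kappa_0-1,\mu_0\}+2k\leqslant\mu_k\leqslant M_k\leqslant\max\{2K_0-1,M_0\}+2k.$$
   Context: Let $S=\{0,1,*\}$; elements of $S^d$ are strings of length $d$. For $u,v\in S^d$ let $\mathrm{dist}(u,v)$ be the number of positions $i$ with $u_i\neq v_i$ and $u_i,v_i\in\{0,1\}$. A list is a finite sequence of strings all of the same length (repetitions allowed); $|L|$ is its number of entries; $[x]$ is the one-entry list of the string $x$; $*^m$ is the string of $m$ jokers $*$. A list $[v_1,\dots,v_n]$ is $k$-neighborly if $1\leqslant\mathrm{dist}(v_i,v_j)\leqslant k$ for all $i\neq j$; a sublist is obtained by deleting entries. Operations: pairing $[v_1,\dots,v_n]\ominus[w_1,\dots,w_n]=[v_1w_1,\dots,v_nw_n]$; concatenation $AB=[v_iw_j]$ (all pairs, ordered lexicographically in $(i,j)$); sum $A+B$ = entries of $A$ followed by entries of $B$; $1\cdot A=A$, $(k+1)\cdot A=k\cdot A+A$; concatenation before sum. A triple $T=(A,B,C)$ of lists is nice if: (1) $\mathrm{dist}(u,v)\leqslant1$ for all entries $u,v$ of $A$; (2)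 $|A|=|B|$ and $A\ominus B$ is $2$-neighborly; (3) $C$ is a $1$-neighborly sublist of $B$ and $\mathrm{dist}(u,v)\leqslant 1$ for all entries $u$ of $B$, $v$ of $C$. $\alpha(T)$, $\beta(T)$ are the lengths of the strings in $A$, $B$; $g(T)=|C|$. Triples $T=(A,B,C)$, $T'=(A',B',C')$ are concordant if $\alpha(T)=\alpha(T')$ and $\mathrm{dist}(u,v)\leqslant1$ for all entries $u,v$ of $A+A'$; "mutually concordant" means every two (not necessarily distinct) members are concordant. Their compound is $T\otimes T'=(A'',B'',C'')$ with $A''=[0]A+[0]A'+[1]\big((g(T)g(T'))\cdot[*^{\alpha(T)}]\big)$, $B''=[0]B[*^{\beta(T')}]+[1][*^{\beta(T)}]B'+[*]CC'$, $C''=[0]C[*^{\beta(T')}]+[1][*^{\beta(T)}]C'$. For a list $L$, let $\mu(L)$ and $M(L)$ be the minimum and maximum, over entries $w$ of $L$, of the number of positions of $w$ occupied by $0$ or $1$. For a triple $T=(A,B,C)$ set $\mu(T)=\mu(A\ominus B)$, $M(T)=M(A\ominus B)$, $\kappa(T)=\mu(C)$, $K(T)=M(C)$. For a non-empty finite set $\mathcal{S}$ of triples, $\mu(\mathcal{S})=\min_{T\in\mathcal{S}}\mu(T)$, $M(\mathcal{S})=\max_{T\in\mathcal{S}}M(T)$, $\kappa(\mathcal{S})=\min_{T\in\mathcal{S}}\kappa(T)$, $K(\mathcal{S})=\max_{T\in\mathcal{S}}K(T)$. -}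

module Defs where

open import Data.Nat using (ℕ; zero; suc; _+_; _*_; _≤_; _⊓_; _⊔_)
open import Data.List using (List; []; _∷_; _++_; map; zipWith; concatMap; concat; replicate; length; lookup)
open import Data.List.Relation.Unary.All using (All)
open import Data.List.Membership.Propositional using (_∈_)
open import Data.List.Relation.Binary.Sublist.Propositional using (_⊆_)
open import Data.Fin using (Fin)
open import Data.Product using (_×_)
open import Relation.Binary.PropositionalEquality using (_≡_; _≢_)

data Sym : Set where
  𝟎 𝟏 ⋆ : Sym

Str : Set
Str = List Sym

SList : Set
SList = List Str

distSym : Sym → Sym → ℕ
distSym 𝟎 𝟏 = 1
distSym 𝟏 𝟎 = 1
distSym _ _ = 0

dist : Str → Str → ℕ
dist (x ∷ xs) (y ∷ ys) = distSym x y + dist xs ys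
dist _ _ = 0

Uniform : ℕ → SList → Set
Uniform d L = All (λ s → length s ≡ d) L

-- k-neighborly (indices, since repetitions are allowed)
Neighborly : ℕ → SList → Set
Neighborly k L = (i j : Fin (length L)) → i ≢ j →
  (1 ≤ dist (lookup L i) (lookup L j)) × (dist (lookup L i) (lookup L j) ≤ k)

_⊖_ : SList → SList → SList
_⊖_ = zipWith _++_

_·_ : SList → SList → SList
A · B = concatMap (λ v → map (v ++_) B) A
infixl 7 _·_

_⋅_ : ℕ → SList → SList
k ⋅ A = concat (replicate k A)

⟦_⟧ : Str → SList
⟦ x ⟧ = x ∷ []

jokers : ℕ → Str
jokers m = replicate m ⋆

record Triple : Set where
  constructor triple
  field
    α β : ℕ
    A B C : SList
open Triple public

g : Triple → ℕ
g T = length (C T)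

Nice : Triple → Set
Nice T =
  Uniform (α T) (A T) × Uniform (β T) (B T) ×
  ((u v : Str) → u ∈ A T → v ∈ A T → dist u v ≤ 1) ×
  (length (A T) ≡ length (B T)) × Neighborly 2 (A T ⊖ B T) ×
  (C T ⊆ B T) × Neighborly 1 (C T) ×
  ((u v : Str) → u ∈ B T → v ∈ C T → dist u v ≤ 1)

Concordant : Triple → Triple → Set
Concordant T T' = (α T ≡ α T') ×
  ((u v : Str) → u ∈ A T ++ A T' → v ∈ A T ++ A T' → dist u v ≤ 1)

_⊗_ : Triple → Triple → Triple
T ⊗ T' = triple (suc (α T)) (suc (β T + β T')) A'' B'' C''
  where
  A'' = ⟦ 𝟎 ∷ [] ⟧ · A T ++ ⟦ 𝟎 ∷ [] ⟧ · A T' ++ ⟦ 𝟏 ∷ [] ⟧ · ((g T * g T') ⋅ ⟦ jokers (α T) ⟧)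
  B'' = ⟦ 𝟎 ∷ [] ⟧ · B T · ⟦ jokers (β T') ⟧ ++ ⟦ 𝟏 ∷ [] ⟧ · ⟦ jokers (β T) ⟧ · B T'
        ++ ⟦ ⋆ ∷ [] ⟧ · C T · C T'
  C'' = ⟦ 𝟎 ∷ [] ⟧ · C T · ⟦ jokers (β T') ⟧ ++ ⟦ 𝟏 ∷ [] ⟧ · ⟦ jokers (β T) ⟧ · C T'

-- 𝒯_k (finite sets represented by lists; duplicates do not affect min/max)
iter : List Triple → ℕ → List Triple
iter 𝒯 zero = 𝒯
iter 𝒯 (suc k) = concatMap (λ S → map (S ⊗_) (iter 𝒯 k)) (iter 𝒯 k)

fixed : Str → ℕ
fixed [] = 0
fixed (⋆ ∷ s) = fixed s
fixed (_ ∷ s) = suc (fixed s)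

-- minimum / maximum of a non-empty list (value on [] is junk, never used under the hypotheses)
minL : List ℕ → ℕ
minL [] = 0
minL (x ∷ []) = x
minL (x ∷ y ∷ ys) = x ⊓ minL (y ∷ ys)

maxL : List ℕ → ℕ
maxL [] = 0
maxL (x ∷ []) = x
maxL (x ∷ y ∷ ys) = x ⊔ maxL (y ∷ ys)

μL ML : SList → ℕ
μL L = minL (map fixed L)
ML L = maxL (map fixed L)

μT MT κT KT : Triple → ℕ
μT T = μL (A T ⊖ B T)
MT T = ML (A T ⊖ B T)
κT T = μL (C T)
KT T = ML (C T)

μS MS κS KS : List Triple → ℕ
μS 𝒮 = minL (map μT 𝒮)
MS 𝒮 = maxL (map MT 𝒮)
κS 𝒮 = minL (map κT 𝒮)
KS 𝒮 = maxL (map KT 𝒮)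

{-# OPTIONS --safe #-}
-- A row of A″ ⊖ B″ in S ⊗ S′ is a row of A ⊖ B or of A′ ⊖ B′ with two more fixed symbols (the
-- leading 0 of A″ and the leading 0 or 1 of B″; the other factor only contributes jokers), or it is
-- 1 *^α ⋆ c c′ with c ∈ C, c′ ∈ C′, which has 1 + fixed c + fixed c′ fixed symbols. An entry of C″ is
-- an entry of C or C′ with one more fixed symbol. So in generation k the entries of C have between
-- κ₀ + k and K₀ + k fixed symbols, and the rows of A ⊖ B stay in the window
-- [min(2κ₀ − 1, μ₀) + 2k, max(2K₀ − 1, M₀) + 2k], which the rows 1 + fixed c + fixed c′ never leave.
-- From niceness only |A| = |B| and C ⊆ B are used (with C ≠ [] they make all minima and maxima
-- attained).
module Submission where

open import Defs
open import Data.Nat as ℕ using (ℕ; zero; suc; s≤s; z≤n)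
open import Data.Nat.Properties
open import Data.List using (List; []; _∷_; _++_; map; zipWith; length; concatMap)
open import Data.List.Properties using (length-++; length-map; ++-conicalˡ; ++-conicalʳ)
open import Data.List.Relation.Unary.Any using (here; there)
open import Data.List.Relation.Unary.All using (All; []; _∷_)
import Data.List.Relation.Unary.All as All
open import Data.List.Relation.Unary.All.Properties using (++⁺; map⁺; concat⁺; zipWith⁺)
open import Data.List.Membership.Propositional using (_∈_)
open import Data.List.Membership.Propositional.Properties using (∈-map⁺)
open import Data.List.Relation.Binary.Pointwise using (Pointwise; []; _∷_)
import Data.List.Relation.Binary.Pointwise as Pointwise
open import Data.List.Relation.Binary.Sublist.Propositional using (_⊆_; []; _∷ʳ_; _∷_)
open import Data.Product using (_×_; _,_; proj₁; proj₂)
open import Data.Sum using (_⊎_; inj₁; inj₂)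
open import Function using (_∘_)
open import Relation.Nullary using (contradiction)
open import Relation.Binary.PropositionalEquality
  using (_≡_; _≢_; refl; sym; trans; cong; cong₂; subst; module ≡-Reasoning)

module _ where
  open import Data.Nat using (_+_; _*_; _∸_; _≤_; _⊓_; _⊔_)

  variable
    ℓ h κ K lo hi lo′ hi′ n : ℕ
    xs : List ℕ
    X Y : SList
    T : Triple

  ++-≢[]ˡ : ∀ {A : Set} {xs ys : List A} → xs ≢ [] → xs ++ ys ≢ []
  ++-≢[]ˡ {xs = xs} {ys} xs≢[] = xs≢[] ∘ ++-conicalˡ xs ys

  ++-≢[]ʳ : ∀ {A : Set} {xs ys : List A} → ys ≢ [] → xs ++ ys ≢ []
  ++-≢[]ʳ {xs = xs} {ys} ys≢[] = ys≢[] ∘ ++-conicalʳ xs ys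

  map-≢[] : ∀ {A B : Set} {f : A → B} {xs : List A} → xs ≢ [] → map f xs ≢ []
  map-≢[] {xs = []}    xs≢[] = contradiction refl xs≢[]
  map-≢[] {xs = _ ∷ _} _     = λ ()

  zipWith-≢[] : ∀ {A B C : Set} {R : A → B → Set} {f : A → B → C} {xs ys} →
                Pointwise R xs ys → ys ≢ [] → zipWith f xs ys ≢ []
  zipWith-≢[] []      ys≢[] = contradiction refl ys≢[]
  zipWith-≢[] (_ ∷ _) _     = λ ()

  zipWith⁻ : ∀ {A B C : Set} {P : C → Set} {f : A → B → C} {xs ys} →
             length xs ≡ length ys → All P (zipWith f xs ys) → Pointwise (λ x y → P (f x y)) xs ys
  zipWith⁻ {xs = []}    {[]}    _  _        = []
  zipWith⁻ {xs = _ ∷ _} {_ ∷ _} eq (p ∷ ps) = p ∷ zipWith⁻ (suc-injective eq) ps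

  ⊆-≢[] : ∀ {A : Set} {xs ys : List A} → xs ⊆ ys → xs ≢ [] → ys ≢ []
  ⊆-≢[] []       xs≢[] = xs≢[]
  ⊆-≢[] (_ ∷ʳ _) _     = λ ()
  ⊆-≢[] (_ ∷ _)  _     = λ ()

  ∈-either : ∀ {A : Set} {x y z : A} {ys} → z ≡ x ⊎ z ≡ y → y ∈ ys → z ∈ x ∷ ys
  ∈-either (inj₁ z≡x) _  = here z≡x
  ∈-either (inj₂ refl) y∈ = there y∈

  minL-∈ : xs ≢ [] → minL xs ∈ xs
  minL-∈ {[]}         xs≢[] = contradiction refl xs≢[]
  minL-∈ {x ∷ []}     _     = here refl
  minL-∈ {x ∷ y ∷ ys} _     = ∈-either (⊓-sel x _) (minL-∈ {y ∷ ys} λ ())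

  maxL-∈ : xs ≢ [] → maxL xs ∈ xs
  maxL-∈ {[]}         xs≢[] = contradiction refl xs≢[]
  maxL-∈ {x ∷ []}     _     = here refl
  maxL-∈ {x ∷ y ∷ ys} _     = ∈-either (⊔-sel x _) (maxL-∈ {y ∷ ys} λ ())

  minL-≤ : ∀ {x} → x ∈ xs → minL xs ≤ x
  minL-≤ {x ∷ []}     (here refl) = ≤-refl
  minL-≤ {x ∷ y ∷ ys} (here refl) = m⊓n≤m x _
  minL-≤ {x ∷ y ∷ ys} (there x∈) = ≤-trans (m⊓n≤n x _) (minL-≤ x∈)

  ≤-maxL : ∀ {x} → x ∈ xs → x ≤ maxL xs
  ≤-maxL {x ∷ []}     (here refl) = ≤-refl
  ≤-maxL {x ∷ y ∷ ys} (here refl) = m≤m⊔n x _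
  ≤-maxL {x ∷ y ∷ ys} (there x∈) = ≤-trans (≤-maxL x∈) (m≤n⊔m x _)

  minL≤maxL : ∀ xs → minL xs ≤ maxL xs
  minL≤maxL []           = z≤n
  minL≤maxL (x ∷ [])     = ≤-refl
  minL≤maxL (x ∷ y ∷ ys) = ≤-trans (m⊓n≤m x _) (m≤m⊔n x _)

  All-minL : ∀ {P : ℕ → Set} → xs ≢ [] → All P xs → P (minL xs)
  All-minL xs≢[] ps = All.lookup ps (minL-∈ xs≢[])

  All-maxL : ∀ {P : ℕ → Set} → xs ≢ [] → All P xs → P (maxL xs)
  All-maxL xs≢[] ps = All.lookup ps (maxL-∈ xs≢[])

  InRange : ℕ → ℕ → ℕ → Set
  InRange lo hi n = lo ≤ n × n ≤ hi

  ∈⇒InRange : ∀ {x} → x ∈ xs → InRange (minL xs) (maxL xs) x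
  ∈⇒InRange x∈ = minL-≤ x∈ , ≤-maxL x∈

  InRange-≡ : ∀ {m} → m ≡ n → InRange lo hi m → InRange lo hi n
  InRange-≡ refl m∈ = m∈

  InRange-weaken : lo′ ≤ lo → hi ≤ hi′ → InRange lo hi n → InRange lo′ hi′ n
  InRange-weaken lo′≤lo hi≤hi′ (lo≤n , n≤hi) = ≤-trans lo′≤lo lo≤n , ≤-trans n≤hi hi≤hi′

  InRange-+ : ∀ m → InRange lo hi n → InRange (m + lo) (m + hi) (m + n)
  InRange-+ m (lo≤n , n≤hi) = +-monoʳ-≤ m lo≤n , +-monoʳ-≤ m n≤hi

  InRange-+-+ : ∀ {m} → InRange lo hi m → InRange lo′ hi′ n → InRange (lo + lo′) (hi + hi′) (m + n)
  InRange-+-+ (lo≤m , m≤hi) (lo′≤n , n≤hi′) = +-mono-≤ lo≤m lo′≤n , +-mono-≤ m≤hi n≤hi′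

  fixed-++ : ∀ x y → fixed (x ++ y) ≡ fixed x + fixed y
  fixed-++ []      y = refl
  fixed-++ (𝟎 ∷ x) y = cong suc (fixed-++ x y)
  fixed-++ (𝟏 ∷ x) y = cong suc (fixed-++ x y)
  fixed-++ (⋆ ∷ x) y = fixed-++ x y

  fixed-jokers : ∀ m → fixed (jokers m) ≡ 0
  fixed-jokers zero    = refl
  fixed-jokers (suc m) = fixed-jokers m

  fixed-jokers-++ : ∀ m s → fixed (jokers m ++ s) ≡ fixed s
  fixed-jokers-++ zero    s = refl
  fixed-jokers-++ (suc m) s = fixed-jokers-++ m s

  fixed-++-jokers : ∀ s m → fixed (s ++ jokers m) ≡ fixed s
  fixed-++-jokers s m = begin
    fixed (s ++ jokers m)       ≡⟨ fixed-++ s (jokers m) ⟩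
    fixed s + fixed (jokers m)  ≡⟨ cong (fixed s +_) (fixed-jokers m) ⟩
    fixed s + 0                 ≡⟨ +-identityʳ (fixed s) ⟩
    fixed s                     ∎
    where open ≡-Reasoning

  fixed-𝟎∷-++ : ∀ a b c → fixed c ≡ suc (fixed b) → fixed ((𝟎 ∷ a) ++ c) ≡ 2 + fixed (a ++ b)
  fixed-𝟎∷-++ a b c fixed-c = begin
    suc (fixed (a ++ c))          ≡⟨ cong suc (fixed-++ a c) ⟩
    suc (fixed a + fixed c)       ≡⟨ cong (λ m → suc (fixed a + m)) fixed-c ⟩
    suc (fixed a + suc (fixed b)) ≡⟨ cong suc (+-suc (fixed a) (fixed b)) ⟩
    2 + (fixed a + fixed b)       ≡⟨ cong (2 +_) (sym (fixed-++ a b)) ⟩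
    2 + fixed (a ++ b)            ∎
    where open ≡-Reasoning

  fixed-𝟏jokers-++ : ∀ m x y → fixed ((𝟏 ∷ jokers m) ++ x ++ y) ≡ suc (fixed x + fixed y)
  fixed-𝟏jokers-++ m x y = cong suc (trans (fixed-jokers-++ m (x ++ y)) (fixed-++ x y))

  All-· : ∀ {P Q R : Str → Set} → All P X → All Q Y →
          (∀ {x y} → P x → Q y → R (x ++ y)) → All R (X · Y)
  All-· []         _   _ = []
  All-· (px ∷ pxs) qys f = ++⁺ (map⁺ (All.map (f px) qys)) (All-· pxs qys f)

  All-⟦⟧· : ∀ {P : Str → Set} {p} → All (λ x → P (p ++ x)) X → All P (⟦ p ⟧ · X)
  All-⟦⟧· []         = []
  All-⟦⟧· (px ∷ pxs) = px ∷ All-⟦⟧· pxs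

  All-·⟦⟧ : ∀ {P : Str → Set} {s} → All (λ x → P (x ++ s)) X → All P (X · ⟦ s ⟧)
  All-·⟦⟧ []         = []
  All-·⟦⟧ (px ∷ pxs) = px ∷ All-·⟦⟧ pxs

  Pointwise-⟦⟧· : ∀ {R : Str → Str → Set} {p q} →
                  Pointwise (λ x y → R (p ++ x) (q ++ y)) X Y → Pointwise R (⟦ p ⟧ · X) (⟦ q ⟧ · Y)
  Pointwise-⟦⟧· []         = []
  Pointwise-⟦⟧· (r ∷ rs) = r ∷ Pointwise-⟦⟧· rs

  Pointwise-·⟦⟧ʳ : ∀ {R : Str → Str → Set} {s} →
                   Pointwise (λ x y → R x (y ++ s)) X Y → Pointwise R X (Y · ⟦ s ⟧)
  Pointwise-·⟦⟧ʳ []       = []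
  Pointwise-·⟦⟧ʳ (r ∷ rs) = r ∷ Pointwise-·⟦⟧ʳ rs

  Pointwise-⋅⟦⟧ˡ : ∀ {R : Str → Str → Set} {x} → n ≡ length Y → All (R x) Y → Pointwise R (n ⋅ ⟦ x ⟧) Y
  Pointwise-⋅⟦⟧ˡ refl []       = []
  Pointwise-⋅⟦⟧ˡ refl (r ∷ rs) = r ∷ Pointwise-⋅⟦⟧ˡ refl rs

  ⟦⟧·-⋅ : ∀ p n x → ⟦ p ⟧ · (n ⋅ ⟦ x ⟧) ≡ n ⋅ ⟦ p ++ x ⟧
  ⟦⟧·-⋅ p zero    x = refl
  ⟦⟧·-⋅ p (suc n) x = cong ((p ++ x) ∷_) (⟦⟧·-⋅ p n x)

  length-· : ∀ X Y → length (X · Y) ≡ length X * length Y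
  length-· []      Y = refl
  length-· (x ∷ X) Y = begin
    length (map (x ++_) Y ++ X · Y)           ≡⟨ length-++ (map (x ++_) Y) ⟩
    length (map (x ++_) Y) + length (X · Y)   ≡⟨ cong₂ _+_ (length-map (x ++_) Y) (length-· X Y) ⟩
    length Y + length X * length Y            ∎
    where open ≡-Reasoning

  ·-≢[] : X ≢ [] → Y ≢ [] → X · Y ≢ []
  ·-≢[] {[]}    {_}     X≢[] _    = contradiction refl X≢[]
  ·-≢[] {_ ∷ _} {[]}    _    Y≢[] = contradiction refl Y≢[]
  ·-≢[] {_ ∷ _} {_ ∷ _} _    _    = λ ()

  -- The lower bound is on 1 + fixed r, so that the initial bound 2κ₀ − 1 needs no subtraction.
  RowIn : ℕ → ℕ → Str → Set
  RowIn ℓ h r = InRange ℓ (suc h) (suc (fixed r))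

  Rows : ℕ → ℕ → SList → SList → Set
  Rows ℓ h = Pointwise (λ a b → RowIn ℓ h (a ++ b))

  FixedIn : ℕ → ℕ → Str → Set
  FixedIn κ K c = InRange κ K (fixed c)

  record Bounded (ℓ h κ K : ℕ) (T : Triple) : Set where
    field
      rows    : Rows ℓ h (A T) (B T)
      B≢[]    : B T ≢ []
      C≢[]    : C T ≢ []
      C-fixed : All (FixedIn κ K) (C T)

  open Bounded

  Nice⇒Bounded : ∀ {T ℓ h κ K} → Nice T → C T ≢ [] → ℓ ≤ suc (μT T) → MT T ≤ h → κ ≤ κT T → KT T ≤ K →
                 Bounded ℓ h κ K T
  Nice⇒Bounded {T} {ℓ} {h} (_ , _ , _ , |A|≡|B| , _ , C⊆B , _) C≢[]′ ℓ≤ ≤h κ≤ ≤K = record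
    { rows    = zipWith⁻ {P = RowIn ℓ h} {f = _++_} |A|≡|B|
                  (All.tabulate λ r∈ → row-bounds (∈⇒InRange (∈-map⁺ fixed r∈)))
    ; B≢[]    = ⊆-≢[] C⊆B C≢[]′
    ; C≢[]    = C≢[]′
    ; C-fixed = All.tabulate λ c∈ → InRange-weaken κ≤ ≤K (∈⇒InRange (∈-map⁺ fixed c∈))
    }
    where
    row-bounds : ∀ {m} → InRange (μT T) (MT T) m → InRange ℓ (suc h) (suc m)
    row-bounds = InRange-weaken ℓ≤ (s≤s ≤h) ∘ InRange-+ 1

  RowIn-𝟎∷ : ∀ {ℓ h} a b c → fixed c ≡ suc (fixed b) →
             RowIn ℓ h (a ++ b) → RowIn (2 + ℓ) (2 + h) ((𝟎 ∷ a) ++ c)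
  RowIn-𝟎∷ a b c fixed-c = InRange-≡ (cong suc (sym (fixed-𝟎∷-++ a b c fixed-c))) ∘ InRange-+ 2

  FixedIn-suc : ∀ {κ K} c c′ → fixed c′ ≡ fixed c →
                FixedIn κ K c → InRange (suc κ) (suc K) (suc (fixed c′))
  FixedIn-suc c c′ c′≡c = InRange-≡ (cong suc (sym c′≡c)) ∘ InRange-+ 1

  ⊗-rows₁ : ∀ {ℓ h} m → Rows ℓ h X Y → Rows (2 + ℓ) (2 + h) (⟦ 𝟎 ∷ [] ⟧ · X) (⟦ 𝟎 ∷ [] ⟧ · Y · ⟦ jokers m ⟧)
  ⊗-rows₁ m = Pointwise-·⟦⟧ʳ ∘ Pointwise-⟦⟧· ∘ Pointwise.map λ {a} {b} →
    RowIn-𝟎∷ a b (𝟎 ∷ b ++ jokers m) (cong suc (fixed-++-jokers b m))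

  ⊗-rows₂ : ∀ {ℓ h} m → Rows ℓ h X Y → Rows (2 + ℓ) (2 + h) (⟦ 𝟎 ∷ [] ⟧ · X) (⟦ 𝟏 ∷ [] ⟧ · ⟦ jokers m ⟧ · Y)
  ⊗-rows₂ m = Pointwise-⟦⟧· ∘ Pointwise.map λ {a} {b} →
    RowIn-𝟎∷ a b (𝟏 ∷ jokers m ++ b) (cong suc (fixed-jokers-++ m b))

  ⊗-rows₃ : ∀ {ℓ h κ K} m {C C′ : SList} → ℓ ≤ 2 * κ → 2 * K ≤ suc h →
            All (FixedIn κ K) C → All (FixedIn κ K) C′ →
            Rows (2 + ℓ) (2 + h) (⟦ 𝟏 ∷ [] ⟧ · ((length C * length C′) ⋅ ⟦ jokers m ⟧)) (⟦ ⋆ ∷ [] ⟧ · C · C′)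
  ⊗-rows₃ {ℓ} {h} {κ} {K} m {C} {C′} ℓ≤2κ 2K≤1+h C-fixed C′-fixed =
    subst (λ X → Rows (2 + ℓ) (2 + h) X (⟦ ⋆ ∷ [] ⟧ · C · C′))
          (sym (⟦⟧·-⋅ (𝟏 ∷ []) (length C * length C′) (jokers m)))
      (Pointwise-⋅⟦⟧ˡ {x = 𝟏 ∷ jokers m} |CC′|≡
        (All-· (All-⟦⟧· {P = FixedIn κ K} {p = ⋆ ∷ []} C-fixed) C′-fixed λ {x} {y} → row {x} {y}))
    where
    2*-≡-+ : ∀ n → 2 * n ≡ n + n
    2*-≡-+ n = cong (n +_) (+-identityʳ n)

    row : ∀ {x y} → FixedIn κ K x → FixedIn κ K y → RowIn (2 + ℓ) (2 + h) ((𝟏 ∷ jokers m) ++ x ++ y)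
    row {x} {y} x-fixed y-fixed =
      InRange-≡ (cong suc (sym (fixed-𝟏jokers-++ m x y)))
        (InRange-+ 2 (InRange-weaken (subst (ℓ ≤_) (2*-≡-+ κ) ℓ≤2κ) (subst (_≤ suc h) (2*-≡-+ K) 2K≤1+h)
          (InRange-+-+ x-fixed y-fixed)))

    |CC′|≡ : length C * length C′ ≡ length (⟦ ⋆ ∷ [] ⟧ · C · C′)
    |CC′|≡ = sym (trans (length-· (⟦ ⋆ ∷ [] ⟧ · C) C′)
                        (cong (_* length C′) (trans (length-· ⟦ ⋆ ∷ [] ⟧ C) (*-identityˡ (length C)))))

  ⊗-C₁ : ∀ {κ K} m {C : SList} → All (FixedIn κ K) C →
         All (FixedIn (suc κ) (suc K)) (⟦ 𝟎 ∷ [] ⟧ · C · ⟦ jokers m ⟧)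
  ⊗-C₁ m = All-·⟦⟧ ∘ All-⟦⟧· ∘ All.map λ {c} → FixedIn-suc c (c ++ jokers m) (fixed-++-jokers c m)

  ⊗-C₂ : ∀ {κ K} m {C : SList} → All (FixedIn κ K) C →
         All (FixedIn (suc κ) (suc K)) (⟦ 𝟏 ∷ [] ⟧ · ⟦ jokers m ⟧ · C)
  ⊗-C₂ m = All-⟦⟧· ∘ All.map λ {c} → FixedIn-suc c (jokers m ++ c) (fixed-jokers-++ m c)

  ⊗-Bounded : ∀ {ℓ h κ K S S′} → ℓ ≤ 2 * κ → 2 * K ≤ suc h → Bounded ℓ h κ K S → Bounded ℓ h κ K S′ →
              Bounded (2 + ℓ) (2 + h) (suc κ) (suc K) (S ⊗ S′)
  ⊗-Bounded {S = S} {S′} ℓ≤2κ 2K≤1+h I I′ = record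
    { rows    = Pointwise.++⁺ (⊗-rows₁ (β S′) (rows I))
                  (Pointwise.++⁺ (⊗-rows₂ (β S) (rows I′))
                    (⊗-rows₃ (α S) ℓ≤2κ 2K≤1+h (C-fixed I) (C-fixed I′)))
    ; B≢[]    = ++-≢[]ʳ {xs = ⟦ 𝟎 ∷ [] ⟧ · B S · ⟦ jokers (β S′) ⟧}
                  (++-≢[]ʳ {xs = ⟦ 𝟏 ∷ [] ⟧ · ⟦ jokers (β S) ⟧ · B S′}
                    (·-≢[] {⟦ ⋆ ∷ [] ⟧ · C S} (·-≢[] {⟦ ⋆ ∷ [] ⟧} (λ ()) (C≢[] I)) (C≢[] I′)))
    ; C≢[]    = ++-≢[]ˡ (·-≢[] {⟦ 𝟎 ∷ [] ⟧ · C S} (·-≢[] {⟦ 𝟎 ∷ [] ⟧} (λ ()) (C≢[] I)) (λ ()))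
    ; C-fixed = ++⁺ (⊗-C₁ (β S′) (C-fixed I)) (⊗-C₂ (β S) (C-fixed I′))
    }

  All-⊗-pairs : ∀ {P Q : Triple → Set} {𝒮} → (∀ {S S′} → P S → P S′ → Q (S ⊗ S′)) →
                All P 𝒮 → All Q (concatMap (λ S → map (S ⊗_) 𝒮) 𝒮)
  All-⊗-pairs f ps = concat⁺ (map⁺ (All.map (λ pS → map⁺ (All.map (f pS) ps)) ps))

  iter-≢[] : ∀ {𝒯} → 𝒯 ≢ [] → ∀ k → iter 𝒯 k ≢ []
  iter-≢[]         𝒯≢[] zero = 𝒯≢[]
  iter-≢[] {𝒯} 𝒯≢[] (suc k) with iter 𝒯 k | iter-≢[] 𝒯≢[] k
  ... | []    | 𝒯ₖ≢[] = contradiction refl 𝒯ₖ≢[]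
  ... | _ ∷ _ | _     = λ ()

  iter-Bounded : ∀ {ℓ h κ K 𝒯} → ℓ ≤ 2 * κ → 2 * K ≤ suc h → All (Bounded ℓ h κ K) 𝒯 →
                 ∀ k → All (Bounded (2 * k + ℓ) (2 * k + h) (k + κ) (k + K)) (iter 𝒯 k)
  iter-Bounded _ _ bounded zero = bounded
  iter-Bounded {ℓ} {h} {κ} {K} {𝒯} ℓ≤2κ 2K≤1+h bounded (suc k) =
    subst (λ m → All (Bounded (m + ℓ) (m + h) (suc k + κ) (suc k + K)) (iter 𝒯 (suc k))) (sym (*-suc 2 k))
      (All-⊗-pairs (⊗-Bounded ℓₖ≤2κₖ 2Kₖ≤1+hₖ) (iter-Bounded ℓ≤2κ 2K≤1+h bounded k))
    where
    open ≤-Reasoning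
    ℓₖ≤2κₖ : 2 * k + ℓ ≤ 2 * (k + κ)
    ℓₖ≤2κₖ = begin
      2 * k + ℓ      ≤⟨ +-monoʳ-≤ (2 * k) ℓ≤2κ ⟩
      2 * k + 2 * κ  ≡⟨ *-distribˡ-+ 2 k κ ⟨
      2 * (k + κ)    ∎
    2Kₖ≤1+hₖ : 2 * (k + K) ≤ suc (2 * k + h)
    2Kₖ≤1+hₖ = begin
      2 * (k + K)    ≡⟨ *-distribˡ-+ 2 k K ⟩
      2 * k + 2 * K  ≤⟨ +-monoʳ-≤ (2 * k) 2K≤1+h ⟩
      2 * k + suc h  ≡⟨ +-suc (2 * k) h ⟩
      suc (2 * k + h) ∎

  μS≤MS : ∀ {𝒮} → 𝒮 ≢ [] → μS 𝒮 ≤ MS 𝒮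
  μS≤MS {[]}    𝒮≢[] = contradiction refl 𝒮≢[]
  μS≤MS {T ∷ 𝒮} _    = begin
    μS (T ∷ 𝒮)  ≤⟨ minL-≤ {map μT (T ∷ 𝒮)} (here refl) ⟩
    μT T        ≤⟨ minL≤maxL (map fixed (A T ⊖ B T)) ⟩
    MT T        ≤⟨ ≤-maxL {map MT (T ∷ 𝒮)} (here refl) ⟩
    MS (T ∷ 𝒮)  ∎
    where open ≤-Reasoning

  rows-fixed : Bounded ℓ h κ K T → All (λ m → InRange ℓ (suc h) (suc m)) (map fixed (A T ⊖ B T))
  rows-fixed I = map⁺ (zipWith⁺ _++_ (rows I))

  rows-fixed-≢[] : Bounded ℓ h κ K T → map fixed (A T ⊖ B T) ≢ []
  rows-fixed-≢[] I = map-≢[] (zipWith-≢[] (rows I) (B≢[] I))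

  μS-lower : ∀ {𝒮} → 𝒮 ≢ [] → All (Bounded ℓ h κ K) 𝒮 → ℓ ≤ suc (μS 𝒮)
  μS-lower {ℓ} 𝒮≢[] bounded =
    All-minL {P = λ m → ℓ ≤ suc m} (map-≢[] 𝒮≢[]) (map⁺ (All.map μT-lower bounded))
    where
    μT-lower : Bounded ℓ h κ K T → ℓ ≤ suc (μT T)
    μT-lower I = proj₁ (All-minL (rows-fixed-≢[] I) (rows-fixed I))

  MS-upper : ∀ {𝒮} → 𝒮 ≢ [] → All (Bounded ℓ h κ K) 𝒮 → MS 𝒮 ≤ h
  MS-upper {h = h} 𝒮≢[] bounded =
    All-maxL {P = _≤ h} (map-≢[] 𝒮≢[]) (map⁺ (All.map MT-upper bounded))
    where
    MT-upper : Bounded ℓ h κ K T → MT T ≤ h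
    MT-upper I = ≤-pred (proj₂ (All-maxL (rows-fixed-≢[] I) (rows-fixed I)))

  -- rowLower 𝒯 − 1 = min(2κ₀ − 1, μ₀), and rowUpper 𝒯 = max(2K₀ − 1, M₀) because M₀ ≥ 0.
  rowLower rowUpper : List Triple → ℕ
  rowLower 𝒯 = (2 * κS 𝒯) ⊓ suc (μS 𝒯)
  rowUpper 𝒯 = (2 * KS 𝒯 ∸ 1) ⊔ MS 𝒯

  initial-Bounded : ∀ {𝒯} → All Nice 𝒯 → All (λ T → C T ≢ []) 𝒯 →
                    All (Bounded (rowLower 𝒯) (rowUpper 𝒯) (κS 𝒯) (KS 𝒯)) 𝒯
  initial-Bounded {𝒯} nice C≢[]′ = All.tabulate λ T∈𝒯 →
    Nice⇒Bounded (All.lookup nice T∈𝒯) (All.lookup C≢[]′ T∈𝒯)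
      (≤-trans (m⊓n≤n _ _) (s≤s (minL-≤ (∈-map⁺ μT T∈𝒯))))
      (≤-trans (≤-maxL (∈-map⁺ MT T∈𝒯)) (m≤n⊔m _ _))
      (minL-≤ (∈-map⁺ κT T∈𝒯))
      (≤-maxL (∈-map⁺ KT T∈𝒯))

  rowLower≤2κ₀ : ∀ 𝒯 → rowLower 𝒯 ≤ 2 * κS 𝒯
  rowLower≤2κ₀ 𝒯 = m⊓n≤m _ _

  2K₀≤1+rowUpper : ∀ 𝒯 → 2 * KS 𝒯 ≤ suc (rowUpper 𝒯)
  2K₀≤1+rowUpper 𝒯 = ≤-trans (m≤n+m∸n (2 * KS 𝒯) 1) (s≤s (m≤m⊔n _ _))

open import Data.Integer using (+_; _+_; _-_; _*_; _⊓_; _⊔_; _≤_; -≤+; +≤+)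
open import Data.Integer.Properties using (pos-*)

[a-1]⊓b+n≤m : ∀ a b n m → n ℕ.+ (a ℕ.⊓ suc b) ℕ.≤ suc m → (+ a - + 1) ⊓ + b + + n ≤ + m
[a-1]⊓b+n≤m zero    b zero    m _ = -≤+
[a-1]⊓b+n≤m zero    b (suc n) m h = +≤+ (≤-pred (subst (ℕ._≤ suc m) (+-identityʳ (suc n)) h))
[a-1]⊓b+n≤m (suc a) b n         m h =
  +≤+ (≤-pred (subst (ℕ._≤ suc m) (trans (+-suc n _) (cong suc (+-comm n _))) h))

m≤[a-1]⊔b+n : ∀ a b n m → m ℕ.≤ n ℕ.+ ((a ℕ.∸ 1) ℕ.⊔ b) → + m ≤ (+ a - + 1) ⊔ + b + + n
m≤[a-1]⊔b+n zero    b n m h = +≤+ (subst (m ℕ.≤_) (+-comm n b) h)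
m≤[a-1]⊔b+n (suc a) b n m h = +≤+ (subst (m ℕ.≤_) (+-comm n _) h)

theorem6 : (𝒯 : List Triple) → 𝒯 ≢ [] → All Nice 𝒯 →
    ((S T : Triple) → S ∈ 𝒯 → T ∈ 𝒯 → Concordant S T) →
    All (λ T → C T ≢ []) 𝒯 →
    (k : ℕ) →
      (((+ 2 * + κS 𝒯 - + 1) ⊓ + μS 𝒯) + + 2 * + k ≤ + μS (iter 𝒯 k)) ×
      (+ μS (iter 𝒯 k) ≤ + MS (iter 𝒯 k)) ×
      (+ MS (iter 𝒯 k) ≤ ((+ 2 * + KS 𝒯 - + 1) ⊔ + MS 𝒯) + + 2 * + k)
theorem6 𝒯 𝒯≢[] nice _ C≢[] k
  rewrite sym (pos-* 2 (κS 𝒯)) | sym (pos-* 2 (KS 𝒯)) | sym (pos-* 2 k) =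
  [a-1]⊓b+n≤m (2 ℕ.* κS 𝒯) (μS 𝒯) (2 ℕ.* k) _ (μS-lower 𝒯ₖ≢[] bounded) ,
  +≤+ (μS≤MS 𝒯ₖ≢[]) ,
  m≤[a-1]⊔b+n (2 ℕ.* KS 𝒯) (MS 𝒯) (2 ℕ.* k) _ (MS-upper 𝒯ₖ≢[] bounded)
  where
  𝒯ₖ≢[] : iter 𝒯 k ≢ []
  𝒯ₖ≢[] = iter-≢[] 𝒯≢[] k
  bounded : All (Bounded (2 ℕ.* k ℕ.+ rowLower 𝒯) (2 ℕ.* k ℕ.+ rowUpper 𝒯) (k ℕ.+ κS 𝒯) (k ℕ.+ KS 𝒯))
                (iter 𝒯 k)
  bounded = iter-Bounded (rowLower≤2κ₀ 𝒯) (2K₀≤1+rowUpper 𝒯) (initial-Bounded nice C≢[]) k
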